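{- Let $f(z)=Az^2+Bz+C\in\mathbb{Z}[z]$ with $A>0$, $\gcd(A,B,C)=1$, and $D:=B^2-4AC$ not a perfect square in $\mathbb{Z}$. Let $M,N$ be positive integers and $r$ an integer with $0\le r\le N$. Suppose $p$ is a prime and $v,l$ are positive integers such that $\gcd(p,4AND)=1$, $v\le p^l$, $f(v)\equiv0\pmod{p^l}$ and $p^l>4AN^2\big(|A|(M+N)^2+|B|(M+N)+|C|\big)$. Then $\big|\frac rN-\frac v{p^l}\big|>\frac M{p^l}$. -}

module Defs where

open import Data.Integer using (ℤ; _+_; _*_; _-_; +_)
open import Data.Product using (Σ)
open import Relation.Binary.PropositionalEquality using (_≡_)

quadEval : ℤ → ℤ → ℤ → ℤ → ℤ
quadEval A B C z = A * z * z + B * z + C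

disc : ℤ → ℤ → ℤ → ℤ
disc A B C = B * B - + 4 * A * C

IsSquare : ℤ → Set
IsSquare z = Σ ℤ (λ w → w * w ≡ z)

module Submission where

-- Idea of the proof (Lemma 4.2).  Write q = p^l, V = v, n = N and consider the
-- integer  Y = V·n − r·q,  so that  v/q − r/N = Y/(N·q).
--
-- * If |Y| > M·N, the rational distance |r/N − v/q| = |Y|/(N·q) exceeds M/q
--   directly.
-- * If |Y| ≤ M·N we derive a contradiction.  With the homogenised form
--   F(Y,n) = A·Y² + B·Y·n + C·n²  one has  n²·f(V) ≡ F(Y,n)  (mod q), hence
--   q ∣ F(Y,n).  The size hypothesis on q gives |F(Y,n)| < q, so F(Y,n) = 0.
--   Completing the square,  4A·F(Y,n) = (2AY + Bn)² − D·n²,  so D·n² is a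
--   perfect square with n ≠ 0, and then D itself is a perfect square — which
--   the hypotheses exclude.

open import Defs
open import Data.Nat as ℕ using (ℕ; suc; NonZero; _^_)
import Data.Nat.Properties as ℕP
import Data.Nat.Divisibility as ℕD
open import Data.Nat.Coprimality as Coprime using (coprime-/gcd; coprime-divisor)
open import Data.Nat.GCD as ℕGCD using (gcd[m,n]∣m; gcd[m,n]∣n; gcd[m,n]≢0)
import Data.Nat.DivMod as ℕDivMod
import Data.Nat.Tactic.RingSolver as ℕSolver
open import Data.Nat.Primality using (Prime)
open import Data.Integer using (ℤ; +_; +<+; +[1+_]; -[1+_]; -_; _+_; _-_; _*_; ∣_∣; _≤_; _<_; _>_; 0ℤ; 1ℤ)
import Data.Integer.Properties as ℤP
import Data.Integer.Tactic.RingSolver as ℤSolver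
open import Data.Integer.GCD using (gcd)
open import Data.Integer.Divisibility using (_∣_)
import Data.Integer.Divisibility.Signed as Signed
open import Data.Rational as ℚ using (_/_)
import Data.Rational.Properties as ℚP
import Data.Rational.Unnormalised as ℚᵘ
import Data.Rational.Unnormalised.Properties as ℚᵘP
open import Data.Product using (Σ; _,_; proj₁; proj₂)
open import Data.Sum using (inj₂)
open import Data.Empty using (⊥-elim)
open import Relation.Binary.PropositionalEquality
open import Relation.Nullary using (¬_; yes; no)

-- If d·n² is a perfect square and n ≠ 0, then d is a perfect square: dividing
-- W² = d·n² by gcd(W,n)² leaves W'² = d·n'² with W', n' coprime, which forces
-- n' ∣ W' and hence n' = 1.
scaled-square⇒square : ∀ d W n .{{_ : NonZero n}} →
                       W ℕ.* W ≡ d ℕ.* (n ℕ.* n) → Σ ℕ (λ k → k ℕ.* k ≡ d)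
scaled-square⇒square d W n W²≡dn² =
  W′ , trans W′²≡dn′² (trans (cong (λ x → d ℕ.* (x ℕ.* x)) n′≡1) (ℕP.*-identityʳ d))
  where
  g = ℕGCD.gcd W n
  instance
    g≢0 : NonZero g
    g≢0 = ℕ.≢-nonZero (gcd[m,n]≢0 W n (inj₂ (ℕ.≢-nonZero⁻¹ n)))
    g²≢0 : NonZero (g ℕ.* g)
    g²≢0 = ℕP.m*n≢0 g g
  W′ = W ℕDivMod./ g
  n′ = n ℕDivMod./ g
  W′g≡W : W′ ℕ.* g ≡ W
  W′g≡W = ℕDivMod.m/n*n≡m (gcd[m,n]∣m W n)
  n′g≡n : n′ ℕ.* g ≡ n
  n′g≡n = ℕDivMod.m/n*n≡m (gcd[m,n]∣n W n)
  squares-of-products : ∀ a b c → (a ℕ.* c) ℕ.* (b ℕ.* c) ≡ (a ℕ.* b) ℕ.* (c ℕ.* c)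
  squares-of-products = ℕSolver.solve-∀
  scaled : ∀ d a c → d ℕ.* ((a ℕ.* c) ℕ.* (a ℕ.* c)) ≡ (d ℕ.* (a ℕ.* a)) ℕ.* (c ℕ.* c)
  scaled = ℕSolver.solve-∀
  W′²≡dn′² : W′ ℕ.* W′ ≡ d ℕ.* (n′ ℕ.* n′)
  W′²≡dn′² = ℕP.*-cancelʳ-≡ _ _ (g ℕ.* g) (begin
    (W′ ℕ.* W′) ℕ.* (g ℕ.* g)        ≡⟨ squares-of-products W′ W′ g ⟨
    (W′ ℕ.* g) ℕ.* (W′ ℕ.* g)        ≡⟨ cong₂ ℕ._*_ W′g≡W W′g≡W ⟩
    W ℕ.* W                          ≡⟨ W²≡dn² ⟩
    d ℕ.* (n ℕ.* n)                  ≡⟨ cong (λ x → d ℕ.* (x ℕ.* x)) n′g≡n ⟨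
    d ℕ.* ((n′ ℕ.* g) ℕ.* (n′ ℕ.* g)) ≡⟨ scaled d n′ g ⟩
    (d ℕ.* (n′ ℕ.* n′)) ℕ.* (g ℕ.* g) ∎)
    where open ≡-Reasoning
  n′∣W′ : n′ ℕD.∣ W′
  n′∣W′ = coprime-divisor (Coprime.sym (coprime-/gcd W n))
            (ℕD.divides (d ℕ.* n′) (trans W′²≡dn′² (sym (ℕP.*-assoc d n′ n′))))
  n′≡1 : n′ ≡ 1
  n′≡1 = coprime-/gcd W n (n′∣W′ , ℕD.∣-refl)

-- The same over ℤ: a negative D cannot equal W²/n², and for D ≥ 0 we pass to
-- absolute values.
scaled-square⇒IsSquare : ∀ D W n .{{_ : NonZero n}} →
                         W * W ≡ D * (+ n * + n) → IsSquare D
scaled-square⇒IsSquare (+ d) W n W²≡dn² = + k , trans (sym (ℤP.pos-* k k)) (cong +_ k²≡d)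
  where
  ∣W∣²≡dn² : ∣ W ∣ ℕ.* ∣ W ∣ ≡ d ℕ.* (n ℕ.* n)
  ∣W∣²≡dn² = begin
    ∣ W ∣ ℕ.* ∣ W ∣               ≡⟨ ℤP.abs-* W W ⟨
    ∣ W * W ∣                     ≡⟨ cong ∣_∣ W²≡dn² ⟩
    ∣ + d * (+ n * + n) ∣         ≡⟨ ℤP.abs-* (+ d) (+ n * + n) ⟩
    d ℕ.* ∣ + n * + n ∣           ≡⟨ cong (d ℕ.*_) (ℤP.abs-* (+ n) (+ n)) ⟩
    d ℕ.* (n ℕ.* n)               ∎
    where open ≡-Reasoning
  k = proj₁ (scaled-square⇒square d ∣ W ∣ n ∣W∣²≡dn²)
  k²≡d = proj₂ (scaled-square⇒square d ∣ W ∣ n ∣W∣²≡dn²)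
scaled-square⇒IsSquare -[1+ d ] (+ w) (suc n) W²≡Dn² with trans (ℤP.pos-* w w) W²≡Dn²
... | ()
scaled-square⇒IsSquare -[1+ d ] -[1+ w ] (suc n) ()

form : ℤ → ℤ → ℤ → ℤ → ℤ → ℤ
form A B C Y n = A * Y * Y + B * Y * n + C * n * n

form-complete-square : ∀ A B C Y n →
  + 4 * A * form A B C Y n ≡ (+ 2 * A * Y + B * n) * (+ 2 * A * Y + B * n) - disc A B C * (n * n)
form-complete-square A B C Y n = expanded A B C Y n
  where
  expanded : ∀ A B C Y n → + 4 * A * (A * Y * Y + B * Y * n + C * n * n)
           ≡ (+ 2 * A * Y + B * n) * (+ 2 * A * Y + B * n) - (B * B - + 4 * A * C) * (n * n)
  expanded = ℤSolver.solve-∀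

form-zero⇒square : ∀ A B C Y n .{{_ : NonZero n}} →
                   form A B C Y (+ n) ≡ 0ℤ → IsSquare (disc A B C)
form-zero⇒square A B C Y n F≡0 = scaled-square⇒IsSquare (disc A B C) W n (ℤP.i-j≡0⇒i≡j _ _ (begin
  W * W - disc A B C * (+ n * + n)  ≡⟨ form-complete-square A B C Y (+ n) ⟨
  + 4 * A * form A B C Y (+ n)      ≡⟨ cong (+ 4 * A *_) F≡0 ⟩
  + 4 * A * 0ℤ                      ≡⟨ ℤP.*-zeroʳ (+ 4 * A) ⟩
  0ℤ                                ∎))
  where
  W = + 2 * A * Y + B * + n
  open ≡-Reasoning

-- Shifting the root:  with Y = V·n − t·q,  n²·f(V) = F(Y,n) + q·(…),
-- so  n²·f(V) ≡ F(Y,n)  (mod q).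
form-shift : ∀ A B C V n t q →
  n * n * quadEval A B C V ≡ form A B C (V * n - t * q) n + q * (t * (A * (V * n + (V * n - t * q)) + B * n))
form-shift A B C V n t q = expanded A B C V n t q
  where
  expanded : ∀ A B C V n t q → n * n * (A * V * V + B * V + C)
    ≡ (A * (V * n - t * q) * (V * n - t * q) + B * (V * n - t * q) * n + C * n * n)
      + q * (t * (A * (V * n + (V * n - t * q)) + B * n))
  expanded = ℤSolver.solve-∀

divides-form : ∀ A B C V n t q → q ∣ quadEval A B C V → q ∣ form A B C (V * n - t * q) n
divides-form A B C V n t q q∣f = Signed.∣⇒∣ᵤ (Signed.∣m+n∣n⇒∣m {q} {F} {q * c} q∣F+qc q∣qc)
  where
  F = form A B C (V * n - t * q) n
  c = t * (A * (V * n + (V * n - t * q)) + B * n)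
  q∣F+qc : q Signed.∣ F + q * c
  q∣F+qc = subst (q Signed.∣_) (form-shift A B C V n t q) (Signed.∣n⇒∣m*n (n * n) (Signed.∣ᵤ⇒∣ q∣f))
  q∣qc : q Signed.∣ q * c
  q∣qc = Signed.∣m⇒∣m*n {q} {q} c (Signed.∣-refl {q})

small-multiple⇒zero : ∀ q g → + q ∣ g → ∣ g ∣ ℕ.< q → g ≡ 0ℤ
small-multiple⇒zero q g q∣g ∣g∣<q with ∣ g ∣ in ∣g∣≡
... | 0     = ℤP.∣i∣≡0⇒i≡0 ∣g∣≡
... | suc k = ⊥-elim (ℕD.>⇒∤ ∣g∣<q q∣g)

form-abs-bound : ∀ A B C Y n →
  ∣ form A B C Y n ∣ ℕ.≤ ∣ A ∣ ℕ.* ∣ Y ∣ ℕ.* ∣ Y ∣ ℕ.+ ∣ B ∣ ℕ.* ∣ Y ∣ ℕ.* ∣ n ∣ ℕ.+ ∣ C ∣ ℕ.* ∣ n ∣ ℕ.* ∣ n ∣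
form-abs-bound A B C Y n = begin
  ∣ A * Y * Y + B * Y * n + C * n * n ∣
    ≤⟨ ℤP.∣i+j∣≤∣i∣+∣j∣ (A * Y * Y + B * Y * n) (C * n * n) ⟩
  ∣ A * Y * Y + B * Y * n ∣ ℕ.+ ∣ C * n * n ∣
    ≤⟨ ℕP.+-monoˡ-≤ _ (ℤP.∣i+j∣≤∣i∣+∣j∣ (A * Y * Y) (B * Y * n)) ⟩
  ∣ A * Y * Y ∣ ℕ.+ ∣ B * Y * n ∣ ℕ.+ ∣ C * n * n ∣
    ≡⟨ cong₂ ℕ._+_ (cong₂ ℕ._+_ (abs-*³ A Y Y) (abs-*³ B Y n)) (abs-*³ C n n) ⟩
  ∣ A ∣ ℕ.* ∣ Y ∣ ℕ.* ∣ Y ∣ ℕ.+ ∣ B ∣ ℕ.* ∣ Y ∣ ℕ.* ∣ n ∣ ℕ.+ ∣ C ∣ ℕ.* ∣ n ∣ ℕ.* ∣ n ∣ ∎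
  where
  open ℕP.≤-Reasoning
  abs-*³ : ∀ x y z → ∣ x * y * z ∣ ≡ ∣ x ∣ ℕ.* ∣ y ∣ ℕ.* ∣ z ∣
  abs-*³ x y z = trans (ℤP.abs-* (x * y) z) (cong (ℕ._* ∣ z ∣) (ℤP.abs-* x y))

natural-bound : ∀ a b c y M N .{{_ : NonZero a}} → y ℕ.≤ M ℕ.* N →
  a ℕ.* y ℕ.* y ℕ.+ b ℕ.* y ℕ.* N ℕ.+ c ℕ.* N ℕ.* N
    ℕ.≤ 4 ℕ.* a ℕ.* N ℕ.* N ℕ.* (a ℕ.* (M ℕ.+ N) ℕ.* (M ℕ.+ N) ℕ.+ b ℕ.* (M ℕ.+ N) ℕ.+ c)
natural-bound a b c y M N y≤MN = begin
  a ℕ.* y ℕ.* y ℕ.+ b ℕ.* y ℕ.* N ℕ.+ c ℕ.* N ℕ.* N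
    ≤⟨ ℕP.+-monoˡ-≤ (c ℕ.* N ℕ.* N) (ℕP.+-mono-≤ (ℕP.*-mono-≤ (ℕP.*-monoʳ-≤ a y≤MN) y≤MN)
                                                 (ℕP.*-monoˡ-≤ N (ℕP.*-monoʳ-≤ b y≤MN))) ⟩
  a ℕ.* (M ℕ.* N) ℕ.* (M ℕ.* N) ℕ.+ b ℕ.* (M ℕ.* N) ℕ.* N ℕ.+ c ℕ.* N ℕ.* N
    ≡⟨ pull-out-N² a b c M N ⟩
  N ℕ.* N ℕ.* (a ℕ.* M ℕ.* M ℕ.+ b ℕ.* M ℕ.+ c)
    ≤⟨ ℕP.*-monoʳ-≤ (N ℕ.* N) (ℕP.+-monoˡ-≤ c (ℕP.+-mono-≤ (ℕP.*-mono-≤ (ℕP.*-monoʳ-≤ a M≤M+N) M≤M+N)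
                                                            (ℕP.*-monoʳ-≤ b M≤M+N))) ⟩
  N ℕ.* N ℕ.* E
    ≤⟨ ℕP.m≤n*m (N ℕ.* N ℕ.* E) (4 ℕ.* a) {{ℕP.m*n≢0 4 a}} ⟩
  4 ℕ.* a ℕ.* (N ℕ.* N ℕ.* E)
    ≡⟨ reassociate (4 ℕ.* a) N E ⟩
  4 ℕ.* a ℕ.* N ℕ.* N ℕ.* E ∎
  where
  open ℕP.≤-Reasoning
  M≤M+N = ℕP.m≤m+n M N
  E = a ℕ.* (M ℕ.+ N) ℕ.* (M ℕ.+ N) ℕ.+ b ℕ.* (M ℕ.+ N) ℕ.+ c
  pull-out-N² : ∀ a b c M N → a ℕ.* (M ℕ.* N) ℕ.* (M ℕ.* N) ℕ.+ b ℕ.* (M ℕ.* N) ℕ.* N ℕ.+ c ℕ.* N ℕ.* N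
                            ≡ N ℕ.* N ℕ.* (a ℕ.* M ℕ.* M ℕ.+ b ℕ.* M ℕ.+ c)
  pull-out-N² = ℕSolver.solve-∀
  reassociate : ∀ x N E → x ℕ.* (N ℕ.* N ℕ.* E) ≡ x ℕ.* N ℕ.* N ℕ.* E
  reassociate = ℕSolver.solve-∀

bound-as-natural : ∀ a b c M N →
  + 4 * + a * + N * + N * (+ a * (+ M + + N) * (+ M + + N) + + b * (+ M + + N) + + c)
    ≡ + (4 ℕ.* a ℕ.* N ℕ.* N ℕ.* (a ℕ.* (M ℕ.+ N) ℕ.* (M ℕ.+ N) ℕ.+ b ℕ.* (M ℕ.+ N) ℕ.+ c))
bound-as-natural a b c M N = sym (begin
  + (4 ℕ.* a ℕ.* N ℕ.* N ℕ.* E)           ≡⟨ ℤP.pos-* (4 ℕ.* a ℕ.* N ℕ.* N) E ⟩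
  + (4 ℕ.* a ℕ.* N ℕ.* N) * + E           ≡⟨ cong₂ _*_ (trans (ℤP.pos-* (4 ℕ.* a ℕ.* N) N) (cong (_* + N) (pos-*³ 4 a N)))
                                                        (cong (_+ + c) (cong₂ _+_ (pos-*³ a (M ℕ.+ N) (M ℕ.+ N)) (ℤP.pos-* b (M ℕ.+ N)))) ⟩
  + 4 * + a * + N * + N * (+ a * (+ M + + N) * (+ M + + N) + + b * (+ M + + N) + + c) ∎)
  where
  open ≡-Reasoning
  E = a ℕ.* (M ℕ.+ N) ℕ.* (M ℕ.+ N) ℕ.+ b ℕ.* (M ℕ.+ N) ℕ.+ c
  pos-*³ : ∀ x y z → + (x ℕ.* y ℕ.* z) ≡ + x * + y * + z
  pos-*³ x y z = trans (ℤP.pos-* (x ℕ.* y) z) (cong (_* + z) (ℤP.pos-* x y))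

form-below-modulus : ∀ a B C Y M N q .{{_ : NonZero a}} → ∣ Y ∣ ℕ.≤ M ℕ.* N →
  + q > + 4 * + a * + N * + N * (+ a * (+ M + + N) * (+ M + + N) + + ∣ B ∣ * (+ M + + N) + + ∣ C ∣) →
  ∣ form (+ a) B C Y (+ N) ∣ ℕ.< q
form-below-modulus a B C Y M N q ∣Y∣≤MN q>bound = ℕP.≤-<-trans
  (ℕP.≤-trans (form-abs-bound (+ a) B C Y (+ N)) (natural-bound a (∣ B ∣) (∣ C ∣) (∣ Y ∣) M N ∣Y∣≤MN))
  (ℤP.drop‿+<+ (subst (_< + q) (bound-as-natural a (∣ B ∣) (∣ C ∣) M N) q>bound))

-- In unnormalised rationals:  |r/N − v/q| = |r·q − v·N| / (N·q), so a numerator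
-- above M·N gives a distance above M/q.
distanceᵘ : ∀ (r : ℤ) v M n q →
  M ℕ.* suc n ℕ.< ∣ r * + suc q + - + v * + suc n ∣ →
  (+ M ℚᵘ./ suc q) ℚᵘ.< ℚᵘ.∣ (r ℚᵘ./ suc n) ℚᵘ.- (+ v ℚᵘ./ suc q) ∣
distanceᵘ r v M n q MN<X = ℚᵘ.*<* (subst₂ _<_ M[nq]≡ Xq≡ (+<+ M[nq]<Xq))
  where
  X = ∣ r * + suc q + - + v * + suc n ∣
  M[nq]<Xq : M ℕ.* (suc n ℕ.* suc q) ℕ.< X ℕ.* suc q
  M[nq]<Xq = subst (ℕ._< X ℕ.* suc q) (ℕP.*-assoc M (suc n) (suc q)) (ℕP.*-monoˡ-< (suc q) MN<X)
  M[nq]≡ : + (M ℕ.* (suc n ℕ.* suc q)) ≡ + M * (+ suc n * + suc q)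
  M[nq]≡ = trans (ℤP.pos-* M (suc n ℕ.* suc q)) (cong (+ M *_) (ℤP.pos-* (suc n) (suc q)))
  Xq≡ : + (X ℕ.* suc q) ≡ + X * + suc q
  Xq≡ = ℤP.pos-* X (suc q)

toℚᵘ-/ : ∀ i n → ℚ.toℚᵘ (i / suc n) ℚᵘ.≃ (i ℚᵘ./ suc n)
toℚᵘ-/ i n = ℚP.toℚᵘ-fromℚᵘ (ℚᵘ.mkℚᵘ i n)

distance-exceeds : ∀ (r : ℤ) v M N q .{{_ : NonZero N}} .{{_ : NonZero q}} →
  M ℕ.* N ℕ.< ∣ + v * + N - r * + q ∣ → ℚ.∣ (r / N) ℚ.- (+ v / q) ∣ ℚ.> (+ M) / q
distance-exceeds r v M (suc n) (suc q) MN<X = ℚP.toℚᵘ-cancel-<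
  (ℚᵘP.<-respˡ-≃ (ℚᵘP.≃-sym (toℚᵘ-/ (+ M) q))
  (ℚᵘP.<-respʳ-≃ (ℚᵘP.≃-sym toℚᵘ-distance)
  (distanceᵘ r v M n q (subst (M ℕ.* suc n ℕ.<_) numerator MN<X))))
  where
  numerator : ∣ + v * + suc n - r * + suc q ∣ ≡ ∣ r * + suc q + - + v * + suc n ∣
  numerator = trans (ℤP.∣i-j∣≡∣j-i∣ (+ v * + suc n) (r * + suc q))
                    (cong (λ x → ∣ r * + suc q + x ∣) (ℤP.neg-distribˡ-* (+ v) (+ suc n)))
  toℚᵘ-distance : ℚ.toℚᵘ ℚ.∣ (r / suc n) ℚ.- (+ v / suc q) ∣
                  ℚᵘ.≃ ℚᵘ.∣ (r ℚᵘ./ suc n) ℚᵘ.- (+ v ℚᵘ./ suc q) ∣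
  toℚᵘ-distance = ℚᵘP.≃-trans (ℚP.toℚᵘ-homo-∣-∣ ((r / suc n) ℚ.- (+ v / suc q)))
    (ℚᵘP.∣-∣-cong (ℚᵘP.≃-trans (ℚP.toℚᵘ-homo-+ (r / suc n) (ℚ.- (+ v / suc q)))
      (ℚᵘP.+-cong (toℚᵘ-/ r n) (ℚᵘP.≃-trans (ℚP.toℚᵘ-homo‿- (+ v / suc q)) (ℚᵘP.-‿cong (toℚᵘ-/ (+ v) q))))))

lemma4p2 : (A B C : ℤ) (M N : ℕ) (r : ℤ) (p l v : ℕ)
    → 0ℤ < A
    → gcd (gcd A B) C ≡ 1ℤ
    → ¬ IsSquare (disc A B C)
    → 0 ℕ.< M → 0 ℕ.< N
    → 0ℤ ≤ r → r ≤ + N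
    → Prime p
    → 0 ℕ.< v → 0 ℕ.< l
    → gcd (+ p) (+ 4 * A * + N * disc A B C) ≡ 1ℤ
    → + v ≤ + (p ^ l)
    → (+ (p ^ l)) ∣ quadEval A B C (+ v)
    → + (p ^ l) > + 4 * A * + N * + N * (+ ∣ A ∣ * (+ M + + N) * (+ M + + N) + + ∣ B ∣ * (+ M + + N) + + ∣ C ∣)
    → .{{_ : NonZero N}} → .{{_ : NonZero (p ^ l)}}
    → ℚ.∣ (r / N) ℚ.- (+ v / (p ^ l)) ∣ ℚ.> (+ M) / (p ^ l)
lemma4p2 (+ 0) B C M N r p l v (+<+ ()) _ _ _ _ _ _ _ _ _ _ _ _ _
lemma4p2 A@(+[1+ a ]) B C M N r p l v _ _ non-square _ _ _ _ _ _ _ _ _ q∣f q>bound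
  with M ℕ.* N ℕ.<? ∣ + v * + N - r * + (p ^ l) ∣
... | yes far  = distance-exceeds r v M N (p ^ l) far
... | no  near = ⊥-elim (non-square (form-zero⇒square A B C Y N F≡0))
  where
  q = p ^ l
  Y = + v * + N - r * + q
  F≡0 : form A B C Y (+ N) ≡ 0ℤ
  F≡0 = small-multiple⇒zero q (form A B C Y (+ N))
          (divides-form A B C (+ v) (+ N) r (+ q) q∣f)
          (form-below-modulus (suc a) B C Y M N q (ℕP.≮⇒≥ near) q>bound)
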